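{- Let $T$ be a tree of order $n\ge 4$ with $2\le \mathrm{diam}(T)\le 3$. Then $\gamma_{tc}(M(T))=2|\mathrm{leaf}(T)|$.
   Context: All graphs are finite, simple and undirected; $\mathrm{diam}(T)$ is the diameter of $T$ and $\mathrm{leaf}(T)=\{v\in V(T)\mid \deg_T(v)=1\}$. For a graph $H$, a set $D\subseteq V(H)$ is a total dominating set if every vertex of $H$ has a neighbor in $D$. A set $D\subseteq V(H)$ is a total outer-connected dominating set of $H$ if $D$ is a total dominating set and the induced subgraph $H[V(H)\setminus D]$ is connected; $\gamma_{tc}(H)$ denotes the minimum cardinality of a total outer-connected dominating set of $H$. The middle graph $M(G)$ of a graph $G$ has vertex set $V(G)\cup E(G)$, where two elements $x,y$ are adjacent iff either $x,y\in E(G)$ are edges of $G$ sharing an endpoint, or one of them is a vertex of $G$ and the other is an edge of $G$ incident to it. -}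

module Defs where

open import Data.Nat using (ℕ; zero; suc; _+_; _*_; _≤_; _≡ᵇ_)
open import Data.Bool using (Bool; true; false; if_then_else_)
open import Data.Fin using (Fin) renaming (_<_ to _<ᶠ_)
open import Data.List using (List; []; _∷_; _++_; [_]; length; map; allFin)
open import Data.Nat.ListAction using (sum)
open import Data.List.Membership.Propositional using (_∈_; _∉_)
open import Data.List.Relation.Unary.Unique.Propositional using (Unique)
open import Data.List.Relation.Unary.Linked using (Linked)
open import Data.Product using (Σ; ∃; ∃-syntax; _×_; _,_; proj₁; proj₂)
open import Data.Sum using (_⊎_; inj₁; inj₂)
open import Data.Empty using (⊥)
open import Relation.Nullary using (¬_)
open import Relation.Binary.PropositionalEquality using (_≡_; _≢_)

record Graph : Set₁ where
  field
    V   : Set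
    Adj : V → V → Set

open Graph public

data Walk (G : Graph) : ℕ → V G → V G → Set where
  here : ∀ {u} → Walk G 0 u u
  step : ∀ {k u w v} → Adj G u w → Walk G k w v → Walk G (suc k) u v

-- walks all of whose vertices satisfy P (used for induced subgraphs)
data WalkIn (G : Graph) (P : V G → Set) : V G → V G → Set where
  here : ∀ {u} → P u → WalkIn G P u u
  step : ∀ {u w v} → P u → Adj G u w → WalkIn G P w v → WalkIn G P u v

Connected : Graph → Set
Connected G = ∀ (u v : V G) → ∃[ k ] Walk G k u v

IsDist : (G : Graph) → V G → V G → ℕ → Set
IsDist G u v d = Walk G d u v × (∀ k → Walk G k u v → d ≤ k)

IsDiameter : Graph → ℕ → Set
IsDiameter G d =
  (∃[ u ] ∃[ v ] IsDist G u v d) × (∀ u v e → IsDist G u v e → e ≤ d)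

-- a cycle: distinct vertices v ∷ vs (at least 3), consecutive ones
-- adjacent, and the last one adjacent to v
HasCycle : Graph → Set
HasCycle G = ∃[ v ] ∃[ vs ]
  (2 ≤ length vs × Unique (v ∷ vs) × Linked (Adj G) (v ∷ vs ++ [ v ]))

Acyclic : Graph → Set
Acyclic G = ¬ HasCycle G

record SimpleGraph (n : ℕ) : Set where
  field
    adj     : Fin n → Fin n → Bool
    symm    : ∀ i j → adj i j ≡ adj j i
    irrefl  : ∀ i → adj i i ≡ false

open SimpleGraph public

toGraph : ∀ {n} → SimpleGraph n → Graph
toGraph {n} G = record { V = Fin n ; Adj = λ i j → adj G i j ≡ true }

IsTree : ∀ {n} → SimpleGraph n → Set
IsTree G = Connected (toGraph G) × Acyclic (toGraph G)

degree : ∀ {n} → SimpleGraph n → Fin n → ℕ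
degree {n} G v = sum (map (λ u → if adj G v u then 1 else 0) (allFin n))

numLeaves : ∀ {n} → SimpleGraph n → ℕ
numLeaves {n} G = sum (map (λ v → if degree G v ≡ᵇ 1 then 1 else 0) (allFin n))

-- edges of G, each represented once as (i , j) with i < j
Edge : ∀ {n} → SimpleGraph n → Set
Edge {n} G = Σ (Fin n × Fin n) (λ p → (proj₁ p <ᶠ proj₂ p) × (adj G (proj₁ p) (proj₂ p) ≡ true))

endpoint : ∀ {n} {G : SimpleGraph n} → Fin n → Edge G → Set
endpoint v ((a , b) , _) = (v ≡ a) ⊎ (v ≡ b)

shareEnd : ∀ {n} {G : SimpleGraph n} → Edge G → Edge G → Set
shareEnd ((a , b) , _) ((c , d) , _) =
  (a ≡ c) ⊎ (a ≡ d) ⊎ (b ≡ c) ⊎ (b ≡ d)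

MAdj : ∀ {n} (G : SimpleGraph n) → (Fin n ⊎ Edge G) → (Fin n ⊎ Edge G) → Set
MAdj G (inj₁ v) (inj₁ w) = ⊥
MAdj G (inj₁ v) (inj₂ e) = endpoint {G = G} v e
MAdj G (inj₂ e) (inj₁ v) = endpoint {G = G} v e
MAdj G (inj₂ e) (inj₂ f) = (proj₁ e ≢ proj₁ f) × shareEnd {G = G} e f

Middle : ∀ {n} → SimpleGraph n → Graph
Middle {n} G = record { V = Fin n ⊎ Edge G ; Adj = MAdj G }

-- Total outer-connected domination.  Vertex subsets are given as
-- duplicate-free lists, whose length is the cardinality.

IsTotalDominating : (H : Graph) → List (V H) → Set
IsTotalDominating H D = ∀ v → ∃[ u ] (u ∈ D × Adj H v u)

-- H[V(H) ∖ D] is connected (vacuously so when it is empty)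
OuterConnected : (H : Graph) → List (V H) → Set
OuterConnected H D = ∀ u v → u ∉ D → v ∉ D → WalkIn H (λ x → x ∉ D) u v

IsTOCDS : (H : Graph) → List (V H) → Set
IsTOCDS H D = IsTotalDominating H D × OuterConnected H D

IsGammaTC : Graph → ℕ → Set
IsGammaTC H k =
  (∃[ D ] (Unique D × IsTOCDS H D × length D ≡ k)) ×
  (∀ D → Unique D → IsTOCDS H D → k ≤ length D)

-- Let L be the set of leaves of T and P the set of pendant edges.  In a tree of
-- diameter at most 3 the non-leaf vertices are pairwise adjacent and each of
-- them is adjacent to a leaf, so L ∪ P totally dominates M(T) and its complement
-- (the non-leaf vertices and the internal edges) induces a connected subgraph.
-- Conversely, in M(T) a leaf is adjacent only to its pendant edge, so every
-- total dominating set D contains P.  If D ⊇ L then |D| ≥ 2|L|.  Otherwise some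
-- leaf lies outside D with all its neighbours inside, and outer-connectedness
-- forces D to contain every other vertex of M(T), in particular a non-leaf
-- vertex of T; again |D| ≥ 2|L|.
-- The diameter bound enters only through the fact that in a tree every
-- non-backtracking walk is a shortest walk, so none has length 4.
module Submission where

open import Defs
open import Axiom.UniquenessOfIdentityProofs using (module Decidable⇒UIP)
open import Data.Bool using (true; false; if_then_else_)
open import Data.Bool.Properties using (T-≡) renaming (_≟_ to _≟ᵇ_)
open import Data.Empty using (⊥; ⊥-elim)
open import Data.Unit using (⊤; tt)
open import Data.Fin using (Fin; zero; suc; fromℕ<)
open import Data.Fin.Properties using (<-cmp; <-asym; <-irrelevant) renaming (_≟_ to _≟ᶠ_)
open import Data.List using (List; []; _∷_; _++_; [_]; length; map; allFin; filter; _ʳ++_)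
open import Data.List.Membership.Propositional using (_∈_; _∉_; find)
open import Data.List.Membership.Propositional.Properties
  using (∈-allFin; ∈-filter⁺; ∈-filter⁻; ∈-map⁺; ∈-map⁻; ∈-++⁺ˡ; ∈-++⁺ʳ; ∈-++⁻; ∈-∃++)
import Data.List.Membership.DecPropositional as DecMembership
open import Data.List.Properties using (length-++; length-map; length-removeAt′)
open import Data.List.Relation.Binary.Subset.Propositional using (_⊆_)
open import Data.List.Relation.Unary.All as All using (All; []; _∷_; all?)
open import Data.List.Relation.Unary.All.Properties using (¬Any⇒All¬; ¬All⇒Any¬; ++⁻ˡ; ++⁻ʳ)
open import Data.List.Relation.Unary.AllPairs using ([]; _∷_)
open import Data.List.Relation.Unary.Any using (here; there; index; _─_)
open import Data.List.Relation.Unary.Linked as Linked using (Linked; []; [-]; _∷_)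
open import Data.List.Relation.Unary.Unique.Propositional using (Unique)
open import Data.List.Relation.Unary.Unique.Propositional.Properties
  using (allFin⁺; filter⁺; map⁺; ++⁺; Unique[x∷xs]⇒x∉xs)
import Data.List.Relation.Unary.Unique.DecPropositional as DecUnique
open import Data.Nat using (ℕ; suc; _+_; _*_; _≤_; z≤n; s≤s; _≤?_)
open import Data.Nat.ListAction using (sum)
open import Data.Nat.Properties using (≤-trans; ≤-pred; n≤1+n; m≤n⇒m≤1+n; <⇒≤; <-irrefl; +-identityʳ; _≟_)
open import Data.Product using (Σ-syntax; ∃-syntax; _×_; _,_; proj₁; proj₂)
open import Data.Product.Properties using () renaming (≡-dec to ×-≡-dec)
open import Data.Sum using (_⊎_; inj₁; inj₂; [_,_]′)
open import Data.Sum.Properties using (inj₁-injective; inj₂-injective) renaming (≡-dec to ⊎-≡-dec)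
open import Function using (_∘_; case_of_)
open import Relation.Binary.Definitions using (DecidableEquality; tri<; tri≈; tri>)
open import Relation.Binary.PropositionalEquality using (_≡_; _≢_; ≢-sym; refl; sym; trans; cong; cong₂; subst; module ≡-Reasoning)
open import Relation.Nullary using (¬_; Dec; yes; no; does)
import Relation.Nullary.Decidable as Dec
open import Relation.Nullary.Decidable using (T?)
open import Relation.Unary using (Pred; Decidable)

module _ {A : Set} where

  ∈-─⁺ : ∀ {x y : A} {ys} (x∈ys : x ∈ ys) → y ∈ ys → y ≢ x → y ∈ (ys ─ x∈ys)
  ∈-─⁺ (here refl)   (here refl)  y≢x = ⊥-elim (y≢x refl)
  ∈-─⁺ (here refl)   (there y∈ys) _   = y∈ys
  ∈-─⁺ (there _)     (here refl)  _   = here refl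
  ∈-─⁺ (there x∈ys)  (there y∈ys) y≢x = there (∈-─⁺ x∈ys y∈ys y≢x)

  Unique-length-≤ : ∀ {xs ys : List A} → Unique xs → xs ⊆ ys → length xs ≤ length ys
  Unique-length-≤ {[]}     _                 _    = z≤n
  Unique-length-≤ {x ∷ xs} {ys} (x∉xs ∷ xs!) xs⊆ys =
    subst (suc (length xs) ≤_) (sym (length-removeAt′ ys (index x∈ys)))
      (s≤s (Unique-length-≤ xs! (λ y∈xs → ∈-─⁺ x∈ys (xs⊆ys (there y∈xs)) (≢-sym (All.lookup x∉xs y∈xs)))))
    where x∈ys = xs⊆ys (here refl)

  Unique-map⁺-on : ∀ {B : Set} {f : A → B} {xs} →
    (∀ {x y} → x ∈ xs → y ∈ xs → f x ≡ f y → x ≡ y) → Unique xs → Unique (map f xs)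
  Unique-map⁺-on {xs = []}     _   []          = []
  Unique-map⁺-on {f = f} {xs = x ∷ xs} inj (x∉xs ∷ xs!) =
    All.tabulate fx∉ ∷ Unique-map⁺-on (λ p q → inj (there p) (there q)) xs!
    where
    fx∉ : ∀ {z} → z ∈ map f xs → f x ≢ z
    fx∉ z∈ fx≡z with ∈-map⁻ f z∈
    ... | y , y∈xs , refl = All.lookup x∉xs y∈xs (inj (here refl) (there y∈xs) fx≡z)

  Unique-++⁻ˡ : ∀ xs {ys : List A} → Unique (xs ++ ys) → Unique xs
  Unique-++⁻ˡ []       _             = []
  Unique-++⁻ˡ (x ∷ xs) (x∉ ∷ xsys!) = ++⁻ˡ xs x∉ ∷ Unique-++⁻ˡ xs xsys!

  Unique-++-∷⇒∉ : ∀ xs {y : A} {ys} → Unique (xs ++ y ∷ ys) → All (y ≢_) xs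
  Unique-++-∷⇒∉ []       _             = []
  Unique-++-∷⇒∉ (x ∷ xs) (x∉ ∷ xsys!) =
    (λ y≡x → All.head (++⁻ʳ xs x∉) (sym y≡x)) ∷ Unique-++-∷⇒∉ xs xsys!

  ʳ++-Unique⁻ʳ : ∀ (xs : List A) {ys} → Unique (xs ʳ++ ys) → Unique ys
  ʳ++-Unique⁻ʳ []       u = u
  ʳ++-Unique⁻ʳ (x ∷ xs) u with ʳ++-Unique⁻ʳ xs u
  ... | _ ∷ ys! = ys!

  ʳ++-¬Unique : ∀ {x : A} {xs ys} → x ∈ xs → x ∈ ys → ¬ Unique (xs ʳ++ ys)
  ʳ++-¬Unique {xs = _ ∷ xs} (here refl)  x∈ys u = Unique[x∷xs]⇒x∉xs (ʳ++-Unique⁻ʳ xs u) x∈ys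
  ʳ++-¬Unique {xs = _ ∷ xs} (there x∈xs) x∈ys u = ʳ++-¬Unique x∈xs (there x∈ys) u

  length≡1⇒∈-unique : ∀ {xs : List A} {x y} → length xs ≡ 1 → x ∈ xs → y ∈ xs → x ≡ y
  length≡1⇒∈-unique {_ ∷ []} _ (here refl) (here refl) = refl

  Unique⇒∃≢ : ∀ {xs : List A} {x} → Unique xs → x ∈ xs → length xs ≢ 1 → ∃[ y ] y ∈ xs × y ≢ x
  Unique⇒∃≢ {_ ∷ []}    _                  (here refl) len≢1 = ⊥-elim (len≢1 refl)
  Unique⇒∃≢ {_ ∷ b ∷ _} ((a≢b ∷ _) ∷ _)   (here refl) _     = b , there (here refl) , ≢-sym a≢b
  Unique⇒∃≢ {a ∷ _ ∷ _} (a∉ ∷ _)          (there x∈) _     = a , here refl , All.lookup a∉ x∈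

  length-filter≡count : ∀ {p} {P : Pred A p} (P? : Decidable P) xs →
    length (filter P? xs) ≡ sum (map (λ x → if does (P? x) then 1 else 0) xs)
  length-filter≡count P? []       = refl
  length-filter≡count P? (x ∷ xs) with does (P? x)
  ... | true  = cong suc (length-filter≡count P? xs)
  ... | false = length-filter≡count P? xs

  Linked-++⁻ˡ : ∀ {R : A → A → Set} xs {y ys} → Linked R (xs ++ y ∷ ys) → Linked R (xs ++ [ y ])
  Linked-++⁻ˡ []            _        = [-]
  Linked-++⁻ˡ (_ ∷ [])      (r ∷ _)  = r ∷ [-]
  Linked-++⁻ˡ (_ ∷ x′ ∷ xs) (r ∷ rs) = r ∷ Linked-++⁻ˡ (x′ ∷ xs) rs

Fin-avoid₂ : ∀ {n} → 3 ≤ n → (a b : Fin n) → ∃[ z ] z ≢ a × z ≢ b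
Fin-avoid₂ (s≤s (s≤s (s≤s _))) zero          zero          = suc zero , (λ ()) , (λ ())
Fin-avoid₂ (s≤s (s≤s (s≤s _))) zero          (suc zero)    = suc (suc zero) , (λ ()) , (λ ())
Fin-avoid₂ (s≤s (s≤s (s≤s _))) zero          (suc (suc _)) = suc zero , (λ ()) , (λ ())
Fin-avoid₂ (s≤s (s≤s (s≤s _))) (suc zero)    zero          = suc (suc zero) , (λ ()) , (λ ())
Fin-avoid₂ (s≤s (s≤s (s≤s _))) (suc (suc _)) zero          = suc zero , (λ ()) , (λ ())
Fin-avoid₂ (s≤s (s≤s (s≤s _))) (suc _)       (suc _)       = zero , (λ ()) , (λ ())

module _ {G : Graph} where

  Walk-closed : (S : V G → Set) → (∀ {x y} → S x → Adj G x y → S y) →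
    ∀ {k u v} → Walk G k u v → S u → S v
  Walk-closed S closed here         Su = Su
  Walk-closed S closed (step uw wv) Su = Walk-closed S closed wv (closed Su uw)

  Walk-first-step : ∀ {k u v} → Walk G k u v → u ≢ v → ∃[ w ] Adj G u w
  Walk-first-step here       u≢u = ⊥-elim (u≢u refl)
  Walk-first-step (step uw _) _  = _ , uw

  module _ {P : V G → Set} where

    WalkIn-head : ∀ {u v} → WalkIn G P u v → P u
    WalkIn-head (here Pu)     = Pu
    WalkIn-head (step Pu _ _) = Pu

    infixr 5 _++ᵂ_
    _++ᵂ_ : ∀ {u w v} → WalkIn G P u w → WalkIn G P w v → WalkIn G P u v
    here _       ++ᵂ q = q
    step Pu uw p ++ᵂ q = step Pu uw (p ++ᵂ q)

OuterConnected-isolated : ∀ G → DecidableEquality (V G) → ∀ {D x} → OuterConnected G D → x ∉ D →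
  (∀ {y} → Adj G x y → y ∈ D) → ∀ y → y ≢ x → y ∈ D
OuterConnected-isolated G _≟ᵛ_ {D} {x} outer x∉D neighbours∈D y y≢x with DecMembership._∈?_ _≟ᵛ_ y D
... | yes y∈D = y∈D
... | no  y∉D = ⊥-elim (stuck (outer x y x∉D y∉D) y≢x)
  where
  stuck : ∀ {z} → WalkIn G (_∉ D) x z → z ≢ x → ⊥
  stuck (here _)     z≢x = z≢x refl
  stuck (step _ xw p) _  = WalkIn-head p (neighbours∈D xw)

-- Non-backtracking walks: in an acyclic graph they are shortest walks

module NonBacktrackingWalks (G : Graph) (_≟ᵛ_ : DecidableEquality (V G))
  (Adj-sym : ∀ {x y} → Adj G x y → Adj G y x) (Adj-irrefl : ∀ {x} → ¬ Adj G x x) where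

  data NonBacktracking : List (V G) → Set where
    []    : NonBacktracking []
    [-]   : ∀ {x} → NonBacktracking [ x ]
    [-,-] : ∀ {x y} → NonBacktracking (x ∷ y ∷ [])
    _∷_   : ∀ {x y z zs} → x ≢ z → NonBacktracking (y ∷ z ∷ zs) → NonBacktracking (x ∷ y ∷ z ∷ zs)

  NonBacktracking-tail : ∀ {x xs} → NonBacktracking (x ∷ xs) → NonBacktracking xs
  NonBacktracking-tail [-]       = []
  NonBacktracking-tail [-,-]     = [-]
  NonBacktracking-tail (_ ∷ nb) = nb

  data Ends (x : V G) : List (V G) → Set where
    here  : Ends x [ x ]
    there : ∀ {y z zs} → Ends x (z ∷ zs) → Ends x (y ∷ z ∷ zs)

  Ends⇒∈ : ∀ {x zs} → Ends x zs → x ∈ zs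
  Ends⇒∈ here      = here refl
  Ends⇒∈ (there e) = there (Ends⇒∈ e)

  -- u ∷ zs lists the vertices of a walk from u to v
  WalkList : V G → V G → List (V G) → Set
  WalkList u v zs = Linked (Adj G) (u ∷ zs) × Ends v (u ∷ zs)

  Walk⇒WalkList : ∀ {k u v} → Walk G k u v → ∃[ zs ] WalkList u v zs × length zs ≡ k
  Walk⇒WalkList here = [] , ([-] , here) , refl
  Walk⇒WalkList (step uw wv) with Walk⇒WalkList wv
  ... | zs , (L , E) , refl = _ ∷ zs , (uw ∷ L , there E) , refl

  WalkList⇒Walk : ∀ {u v} zs → WalkList u v zs → Walk G (length zs) u v
  WalkList⇒Walk []       ([-] , here)      = here
  WalkList⇒Walk (_ ∷ zs) (uz ∷ L , there E) = step uz (WalkList⇒Walk zs (L , E))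

  -- Cancelling each immediate return x → y → x.
  shorten : ∀ {u v} zs → WalkList u v zs →
    Σ[ r ∈ List (V G) ] (WalkList u v r × NonBacktracking (u ∷ r)) × length r ≤ length zs
  shorten []       W = [] , (W , [-]) , z≤n
  shorten {u} (z ∷ zs) (uz ∷ L , there E) with shorten zs (L , E)
  ... | [] , ((L′ , E′) , _) , _ = [ z ] , ((uz ∷ L′ , there E′) , [-,-]) , s≤s z≤n
  ... | r₁ ∷ r , ((zr₁ ∷ L′ , there E′) , N) , r<zs with u ≟ᵛ r₁
  ...   | yes refl = r , ((L′ , E′) , NonBacktracking-tail N) , m≤n⇒m≤1+n (<⇒≤ r<zs)
  ...   | no  u≢r₁ = z ∷ r₁ ∷ r , ((uz ∷ zr₁ ∷ L′ , there (there E′)) , u≢r₁ ∷ N) , s≤s r<zs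

  triangle⇒cycle : ∀ {x y z} → Adj G x y → Adj G y z → Adj G z x → HasCycle G
  triangle⇒cycle xy yz zx =
    _ , _ ∷ _ ∷ [] , s≤s (s≤s z≤n) ,
    ((≢ xy ∷ ≢ (Adj-sym zx) ∷ []) ∷ (≢ yz ∷ []) ∷ [] ∷ []) ,
    (xy ∷ yz ∷ zx ∷ [-])
    where
    ≢ : ∀ {a b} → Adj G a b → a ≢ b
    ≢ ab refl = Adj-irrefl ab

  closedWalk⇒cycle : ∀ y as bs → Linked (Adj G) (y ∷ as ++ y ∷ bs) →
    NonBacktracking (y ∷ as ++ y ∷ bs) → Unique (as ++ y ∷ bs) → HasCycle G
  closedWalk⇒cycle y []           bs (yy ∷ _) _       _ = ⊥-elim (Adj-irrefl yy)
  closedWalk⇒cycle y (a ∷ [])     bs _        (y≢y ∷ _) _ = ⊥-elim (y≢y refl)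
  closedWalk⇒cycle y as@(_ ∷ _ ∷ _) bs L   _        u =
    y , as , s≤s (s≤s z≤n) , Unique-++-∷⇒∉ as u ∷ Unique-++⁻ˡ as u , Linked-++⁻ˡ (y ∷ as) L

  -- A repeated vertex closes a cycle; non-backtracking excludes cycles of length 1 and 2.
  duplicate⇒cycle : ∀ zs → Linked (Adj G) zs → NonBacktracking zs → ¬ Unique zs → HasCycle G
  duplicate⇒cycle []       _ _ ¬u = ⊥-elim (¬u [])
  duplicate⇒cycle (y ∷ ys) L N ¬u with DecUnique.unique? _≟ᵛ_ ys
  ... | no ¬u′ = duplicate⇒cycle ys (Linked.tail L) (NonBacktracking-tail N) ¬u′
  ... | yes u with DecMembership._∈?_ _≟ᵛ_ y ys
  ...   | no  y∉ys = ⊥-elim (¬u (¬Any⇒All¬ ys y∉ys ∷ u))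
  ...   | yes y∈ys with ∈-∃++ y∈ys
  ...     | as , bs , refl = closedWalk⇒cycle y as bs L N u

  HeadsDiffer : List (V G) → List (V G) → Set
  HeadsDiffer (a ∷ _) (b ∷ _) = a ≢ b
  HeadsDiffer _       _       = ⊤

  ʳ++-Linked : ∀ w W S → Linked (Adj G) (w ∷ W) → Linked (Adj G) (w ∷ S) → Linked (Adj G) (W ʳ++ w ∷ S)
  ʳ++-Linked w []       S _         LS = LS
  ʳ++-Linked w (w′ ∷ W) S (ww′ ∷ LW) LS = ʳ++-Linked w′ W (w ∷ S) LW (Adj-sym ww′ ∷ LS)

  ʳ++-NonBacktracking : ∀ w W S → NonBacktracking (w ∷ W) → NonBacktracking (w ∷ S) →
    HeadsDiffer W S → NonBacktracking (W ʳ++ w ∷ S)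
  ʳ++-NonBacktracking w []       S _  NS _ = NS
  ʳ++-NonBacktracking w (w′ ∷ W) S NW NS w′≢s =
    ʳ++-NonBacktracking w′ W (w ∷ S) (NonBacktracking-tail NW) (prepend S NS w′≢s) (next W NW)
    where
    prepend : ∀ S → NonBacktracking (w ∷ S) → HeadsDiffer (w′ ∷ W) S → NonBacktracking (w′ ∷ w ∷ S)
    prepend []      _  _    = [-,-]
    prepend (_ ∷ _) NS w′≢s = w′≢s ∷ NS
    next : ∀ W → NonBacktracking (w ∷ w′ ∷ W) → HeadsDiffer W (w ∷ S)
    next []      _           = tt
    next (_ ∷ _) (w≢w″ ∷ _) = ≢-sym w≢w″

  -- Past their common prefix, one walk reversed followed by the other is
  -- non-backtracking and visits x twice.
  different-lengths⇒cycle : ∀ {y x} W S →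
    Linked (Adj G) (y ∷ W) → NonBacktracking (y ∷ W) → Ends x (y ∷ W) →
    Linked (Adj G) (y ∷ S) → NonBacktracking (y ∷ S) → Ends x (y ∷ S) →
    length W ≢ length S → HasCycle G
  different-lengths⇒cycle [] [] _ _ _ _ _ _ W≢S = ⊥-elim (W≢S refl)
  different-lengths⇒cycle [] (s ∷ S) _ _ here LS NS (there E) _ =
    duplicate⇒cycle (_ ∷ s ∷ S) LS NS (λ u → Unique[x∷xs]⇒x∉xs u (Ends⇒∈ E))
  different-lengths⇒cycle (w ∷ W) [] LW NW (there E) _ _ here _ =
    duplicate⇒cycle (_ ∷ w ∷ W) LW NW (λ u → Unique[x∷xs]⇒x∉xs u (Ends⇒∈ E))
  different-lengths⇒cycle {y} (w ∷ W) (s ∷ S) LW NW (there EW) LS NS (there ES) W≢S with w ≟ᵛ s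
  ... | yes refl =
    different-lengths⇒cycle W S (Linked.tail LW) (NonBacktracking-tail NW) EW
      (Linked.tail LS) (NonBacktracking-tail NS) ES (W≢S ∘ cong suc)
  ... | no w≢s =
    duplicate⇒cycle ((w ∷ W) ʳ++ y ∷ s ∷ S) (ʳ++-Linked y (w ∷ W) (s ∷ S) LW LS)
      (ʳ++-NonBacktracking y (w ∷ W) (s ∷ S) NW NS w≢s)
      (ʳ++-¬Unique (Ends⇒∈ EW) (there (Ends⇒∈ ES)))

  NonBacktracking⇒IsDist : Acyclic G → ∀ {u v} zs → WalkList u v zs → NonBacktracking (u ∷ zs) →
    IsDist G u v (length zs)
  NonBacktracking⇒IsDist acyclic zs (L , E) N = WalkList⇒Walk zs (L , E) , shortest
    where
    shortest : ∀ k → Walk G k _ _ → length zs ≤ k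
    shortest k w with length zs ≤? k
    ... | yes zs≤k = zs≤k
    ... | no  zs≰k with Walk⇒WalkList w
    ...   | ys , W , refl with shorten ys W
    ...     | r , ((L′ , E′) , N′) , r≤ys =
      ⊥-elim (acyclic (different-lengths⇒cycle zs r L N E L′ N′ E′
        (λ zs≡r → zs≰k (subst (_≤ length ys) (sym zs≡r) r≤ys))))

module Neighbourhoods {n} (T : SimpleGraph n) where

  Adjacent : Fin n → Fin n → Set
  Adjacent u v = adj T u v ≡ true

  adjacent-sym : ∀ {u v} → Adjacent u v → Adjacent v u
  adjacent-sym {u} {v} uv = trans (symm T v u) uv

  adjacent-irrefl : ∀ {u} → ¬ Adjacent u u
  adjacent-irrefl {u} uu with trans (sym (irrefl T u)) uu
  ... | ()

  adjacent⇒≢ : ∀ {u v} → Adjacent u v → u ≢ v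
  adjacent⇒≢ uv refl = adjacent-irrefl uv

  adjacent? : ∀ u v → Dec (Adjacent u v)
  adjacent? u v = Dec.map T-≡ (T? (adj T u v))

  neighbours : Fin n → List (Fin n)
  neighbours v = filter (adjacent? v) (allFin n)

  ∈-neighbours : ∀ {u v} → Adjacent v u → u ∈ neighbours v
  ∈-neighbours {u} {v} vu = ∈-filter⁺ (adjacent? v) (∈-allFin u) vu

  ∈-neighbours⁻ : ∀ {u v} → u ∈ neighbours v → Adjacent v u
  ∈-neighbours⁻ {v = v} u∈ = proj₂ (∈-filter⁻ (adjacent? v) {xs = allFin n} u∈)

  length-neighbours : ∀ v → length (neighbours v) ≡ degree T v
  length-neighbours v = length-filter≡count (adjacent? v) (allFin n)

  Leaf : Fin n → Set
  Leaf v = degree T v ≡ 1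

  leaf? : ∀ v → Dec (Leaf v)
  leaf? v = degree T v ≟ 1

  leaves : List (Fin n)
  leaves = filter leaf? (allFin n)

  leaves-unique : Unique leaves
  leaves-unique = filter⁺ leaf? (allFin⁺ n)

  ∈-leaves : ∀ {l} → Leaf l → l ∈ leaves
  ∈-leaves {l} lf = ∈-filter⁺ leaf? (∈-allFin l) lf

  ∈-leaves⁻ : ∀ {l} → l ∈ leaves → Leaf l
  ∈-leaves⁻ l∈ = proj₂ (∈-filter⁻ leaf? {xs = allFin n} l∈)

  length-leaves : length leaves ≡ numLeaves T
  length-leaves = length-filter≡count leaf? (allFin n)

  leaf-neighbour-unique : ∀ {l a b} → Leaf l → Adjacent l a → Adjacent l b → a ≡ b
  leaf-neighbour-unique {l} lf la lb =
    length≡1⇒∈-unique (trans (length-neighbours l) lf) (∈-neighbours la) (∈-neighbours lb)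

  nonleaf-other-neighbour : ∀ {v m} → ¬ Leaf v → Adjacent v m → ∃[ m′ ] Adjacent v m′ × m′ ≢ m
  nonleaf-other-neighbour {v} nl vm
    with Unique⇒∃≢ (filter⁺ (adjacent? v) (allFin⁺ n)) (∈-neighbours vm) (nl ∘ trans (sym (length-neighbours v)))
  ... | m′ , m′∈ , m′≢m = m′ , ∈-neighbours⁻ m′∈ , m′≢m

module ConnectedGraph {n} (T : SimpleGraph n) (connected : Connected (toGraph T)) (n≥3 : 3 ≤ n) where

  open Neighbourhoods T public
  open NonBacktrackingWalks (toGraph T) _≟ᶠ_ adjacent-sym adjacent-irrefl

  has-neighbour : ∀ v → ∃[ w ] Adjacent v w
  has-neighbour v with Fin-avoid₂ n≥3 v v
  ... | z , z≢v , _ = Walk-first-step (proj₂ (connected v z)) (≢-sym z≢v)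

  leaves-nonadjacent : ∀ {l l′} → Leaf l → Leaf l′ → ¬ Adjacent l l′
  leaves-nonadjacent {l} {l′} lf lf′ ll′ with Fin-avoid₂ n≥3 l l′
  ... | z , z≢l , z≢l′ =
    [ z≢l , z≢l′ ]′ (Walk-closed InPair closed (proj₂ (connected l z)) (inj₁ refl))
    where
    InPair : Fin n → Set
    InPair x = x ≡ l ⊎ x ≡ l′
    closed : ∀ {x y} → InPair x → Adjacent x y → InPair y
    closed (inj₁ refl) ly  = inj₂ (leaf-neighbour-unique lf ly ll′)
    closed (inj₂ refl) l′y = inj₁ (leaf-neighbour-unique lf′ l′y (adjacent-sym ll′))

  nonleaf-exists : ∃[ w ] ¬ Leaf w
  nonleaf-exists with fromℕ< n≥3 | has-neighbour (fromℕ< n≥3)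
  ... | v | w , vw with leaf? v | leaf? w
  ...   | no  nv | _     = v , nv
  ...   | yes _  | no nw = w , nw
  ...   | yes lv | yes lw = ⊥-elim (leaves-nonadjacent lv lw vw)

  module DiameterAtMost3 (acyclic : Acyclic (toGraph T)) {d} (diam : IsDiameter (toGraph T) d) (d≤3 : d ≤ 3) where

    no-nonbacktracking-4-walk : ∀ {a b c e f} → Adjacent a b → Adjacent b c → Adjacent c e → Adjacent e f →
      a ≢ c → b ≢ e → c ≢ f → ⊥
    no-nonbacktracking-4-walk {a} {f = f} ab bc ce ef a≢c b≢e c≢f =
      <-irrefl refl (≤-trans (proj₂ diam a f 4 dist≡4) d≤3)
      where
      dist≡4 = NonBacktracking⇒IsDist acyclic (_ ∷ _ ∷ _ ∷ _ ∷ [])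
                 (ab ∷ bc ∷ ce ∷ ef ∷ [-] , there (there (there (there here))))
                 (a≢c ∷ b≢e ∷ c≢f ∷ [-,-])

    nonleaves-adjacent : ∀ {u v} → ¬ Leaf u → ¬ Leaf v → u ≢ v → Adjacent u v
    nonleaves-adjacent {u} {v} nu nv u≢v with Walk⇒WalkList (proj₂ (connected u v))
    ... | zs , W , _ with shorten zs W
    ...   | r , ((L , E) , N) , _ = adjacent-along r L N E
      where
      -- A non-backtracking walk of length 2 or 3 extends at its non-leaf ends to one of length 4.
      adjacent-along : ∀ r → Linked Adjacent (u ∷ r) → NonBacktracking (u ∷ r) → Ends v (u ∷ r) → Adjacent u v
      adjacent-along [] _ _ here = ⊥-elim (u≢v refl)
      adjacent-along (_ ∷ []) (um ∷ _) _ (there here) = um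
      adjacent-along (m ∷ _ ∷ []) (um ∷ mv ∷ _) _ (there (there here))
        with nonleaf-other-neighbour nu um | nonleaf-other-neighbour nv (adjacent-sym mv)
      ... | u′ , uu′ , u′≢m | v′ , vv′ , v′≢m =
        ⊥-elim (no-nonbacktracking-4-walk (adjacent-sym uu′) um mv vv′ u′≢m u≢v (≢-sym v′≢m))
      adjacent-along (_ ∷ m₂ ∷ _ ∷ []) (um₁ ∷ m₁m₂ ∷ m₂v ∷ _) (u≢m₂ ∷ m₁≢v ∷ _) (there (there (there here)))
        with nonleaf-other-neighbour nv (adjacent-sym m₂v)
      ... | v′ , vv′ , v′≢m₂ =
        ⊥-elim (no-nonbacktracking-4-walk um₁ m₁m₂ m₂v vv′ u≢m₂ m₁≢v (≢-sym v′≢m₂))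
      adjacent-along (_ ∷ _ ∷ _ ∷ _ ∷ _) (a ∷ b ∷ c ∷ e ∷ _) (≢₁ ∷ ≢₂ ∷ ≢₃ ∷ _) _ =
        ⊥-elim (no-nonbacktracking-4-walk a b c e ≢₁ ≢₂ ≢₃)

    nonleaf-has-leaf-neighbour : ∀ {v} → ¬ Leaf v → ∃[ l ] Leaf l × Adjacent v l
    nonleaf-has-leaf-neighbour {v} nv with has-neighbour v
    ... | a , va with leaf? a
    ...   | yes la = a , la , va
    ...   | no  na with nonleaf-other-neighbour nv va
    ...     | b , vb , b≢a with leaf? b
    ...       | yes lb = b , lb , vb
    ...       | no  nb = ⊥-elim (acyclic (triangle⇒cycle va (nonleaves-adjacent na nb (≢-sym b≢a)) (adjacent-sym vb)))

module Edges {n} (T : SimpleGraph n) where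

  open Neighbourhoods T using (Adjacent; adjacent-sym; adjacent⇒≢)

  _∈ᴱ_ : Fin n → Edge T → Set
  v ∈ᴱ e = endpoint {G = T} v e

  edge : ∀ a b → Adjacent a b → Edge T
  edge a b ab with <-cmp a b
  ... | tri< a<b _ _   = (a , b) , a<b , ab
  ... | tri≈ _ a≡b _   = ⊥-elim (adjacent⇒≢ ab a≡b)
  ... | tri> _ _ b<a   = (b , a) , b<a , adjacent-sym ab

  edge-ends : ∀ a b (ab : Adjacent a b) → a ∈ᴱ edge a b ab × b ∈ᴱ edge a b ab
  edge-ends a b ab with <-cmp a b
  ... | tri< _ _ _     = inj₁ refl , inj₂ refl
  ... | tri≈ _ a≡b _   = ⊥-elim (adjacent⇒≢ ab a≡b)
  ... | tri> _ _ _     = inj₂ refl , inj₁ refl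

  edge-ends⁻ : ∀ {a b v} (ab : Adjacent a b) → v ∈ᴱ edge a b ab → v ≡ a ⊎ v ≡ b
  edge-ends⁻ {a} {b} ab v∈ with <-cmp a b | v∈
  ... | tri< _ _ _   | v∈′       = v∈′
  ... | tri≈ _ a≡b _ | _         = ⊥-elim (adjacent⇒≢ ab a≡b)
  ... | tri> _ _ _   | inj₁ v≡b = inj₂ v≡b
  ... | tri> _ _ _   | inj₂ v≡a = inj₁ v≡a

  Edge-≡ : ∀ {e f : Edge T} → proj₁ e ≡ proj₁ f → e ≡ f
  Edge-≡ {_ , a<b , ab} {_ , a<b′ , ab′} refl
    rewrite <-irrelevant a<b a<b′ | Decidable⇒UIP.≡-irrelevant _≟ᵇ_ ab ab′ = refl

  _≟ᴱ_ : DecidableEquality (Edge T)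
  e ≟ᴱ f with ×-≡-dec _≟ᶠ_ _≟ᶠ_ (proj₁ e) (proj₁ f)
  ... | yes e≡f = yes (Edge-≡ e≡f)
  ... | no  e≢f = no (e≢f ∘ cong proj₁)

  _≟ᴹ_ : DecidableEquality (V (Middle T))
  _≟ᴹ_ = ⊎-≡-dec _≟ᶠ_ _≟ᴱ_

  other-end : ∀ {x} e → x ∈ᴱ e → ∃[ y ] y ∈ᴱ e × Adjacent x y
  other-end ((_ , b) , _ , ab) (inj₁ refl) = b , inj₂ refl , ab
  other-end ((a , _) , _ , ab) (inj₂ refl) = a , inj₁ refl , adjacent-sym ab

  -- Holds because edges store their ends in increasing order.
  edge-determined : ∀ {x y} e f → x ∈ᴱ e → y ∈ᴱ e → x ∈ᴱ f → y ∈ᴱ f → x ≢ y → e ≡ f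
  edge-determined {x} {y} e f xe ye xf yf x≢y = Edge-≡ (same-ends e f xe ye xf yf)
    where
    same-ends : ∀ e f → x ∈ᴱ e → y ∈ᴱ e → x ∈ᴱ f → y ∈ᴱ f → proj₁ e ≡ proj₁ f
    same-ends _ _ (inj₁ refl) (inj₁ refl) _ _ = ⊥-elim (x≢y refl)
    same-ends _ _ (inj₂ refl) (inj₂ refl) _ _ = ⊥-elim (x≢y refl)
    same-ends _ _ _ _ (inj₁ refl) (inj₁ refl) = ⊥-elim (x≢y refl)
    same-ends _ _ _ _ (inj₂ refl) (inj₂ refl) = ⊥-elim (x≢y refl)
    same-ends _ _ (inj₁ refl) (inj₂ refl) (inj₁ refl) (inj₂ refl) = refl
    same-ends _ _ (inj₂ refl) (inj₁ refl) (inj₂ refl) (inj₁ refl) = refl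
    same-ends (_ , a<b , _) (_ , b<a , _) (inj₁ refl) (inj₂ refl) (inj₂ refl) (inj₁ refl) = ⊥-elim (<-asym a<b b<a)
    same-ends (_ , b<a , _) (_ , a<b , _) (inj₂ refl) (inj₁ refl) (inj₁ refl) (inj₂ refl) = ⊥-elim (<-asym b<a a<b)

  ends⇒shareEnd : ∀ {x} e f → x ∈ᴱ e → x ∈ᴱ f → shareEnd {G = T} e f
  ends⇒shareEnd _ _ (inj₁ refl) (inj₁ refl) = inj₁ refl
  ends⇒shareEnd _ _ (inj₁ refl) (inj₂ refl) = inj₂ (inj₁ refl)
  ends⇒shareEnd _ _ (inj₂ refl) (inj₁ refl) = inj₂ (inj₂ (inj₁ refl))
  ends⇒shareEnd _ _ (inj₂ refl) (inj₂ refl) = inj₂ (inj₂ (inj₂ refl))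

module PendantEdges {n} (T : SimpleGraph n) (connected : Connected (toGraph T)) (n≥3 : 3 ≤ n) where

  open ConnectedGraph T connected n≥3
  open Edges T
  open DecMembership _≟ᴹ_ using (_∈?_)

  -- For a non-leaf v this is just some edge at v.
  pendant : Fin n → Edge T
  pendant v = edge v (proj₁ (has-neighbour v)) (proj₂ (has-neighbour v))

  pendant-end : ∀ v → v ∈ᴱ pendant v
  pendant-end v = proj₁ (edge-ends v _ (proj₂ (has-neighbour v)))

  pendant-end-at-neighbour : ∀ {v l} → Leaf l → Adjacent v l → v ∈ᴱ pendant l
  pendant-end-at-neighbour {v} {l} lf vl =
    subst (_∈ᴱ pendant l) (leaf-neighbour-unique lf (proj₂ (has-neighbour l)) (adjacent-sym vl))
      (proj₂ (edge-ends l _ (proj₂ (has-neighbour l))))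

  pendant-unique : ∀ {l e} → Leaf l → l ∈ᴱ e → e ≡ pendant l
  pendant-unique {l} {e} lf l∈e with other-end e l∈e
  ... | q , q∈e , lq =
    edge-determined e (pendant l) l∈e q∈e (pendant-end l) (pendant-end-at-neighbour lf (adjacent-sym lq))
      (adjacent⇒≢ lq)

  pendant-injective : ∀ {x y} → Leaf x → Leaf y → pendant x ≡ pendant y → x ≡ y
  pendant-injective {x} {y} lx ly px≡py
    with edge-ends⁻ (proj₂ (has-neighbour x)) (subst (y ∈ᴱ_) (sym px≡py) (pendant-end y))
  ... | inj₁ y≡x = sym y≡x
  ... | inj₂ refl = ⊥-elim (leaves-nonadjacent lx ly (proj₂ (has-neighbour x)))

  D₀ : List (V (Middle T))
  D₀ = map inj₁ leaves ++ map (inj₂ ∘ pendant) leaves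

  leaf∈D₀ : ∀ {l} → Leaf l → inj₁ l ∈ D₀
  leaf∈D₀ lf = ∈-++⁺ˡ (∈-map⁺ inj₁ (∈-leaves lf))

  pendant∈D₀ : ∀ {l} → Leaf l → inj₂ (pendant l) ∈ D₀
  pendant∈D₀ lf = ∈-++⁺ʳ (map inj₁ leaves) (∈-map⁺ (inj₂ ∘ pendant) (∈-leaves lf))

  ∈-D₀⁻ : ∀ {x} → x ∈ D₀ → (∃[ l ] Leaf l × x ≡ inj₁ l) ⊎ (∃[ l ] Leaf l × x ≡ inj₂ (pendant l))
  ∈-D₀⁻ x∈ with ∈-++⁻ (map inj₁ leaves) x∈
  ... | inj₁ x∈₁ with ∈-map⁻ inj₁ x∈₁
  ...   | l , l∈ , x≡ = inj₁ (l , ∈-leaves⁻ l∈ , x≡)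
  ∈-D₀⁻ x∈ | inj₂ x∈₂ with ∈-map⁻ (inj₂ ∘ pendant) x∈₂
  ...   | l , l∈ , x≡ = inj₂ (l , ∈-leaves⁻ l∈ , x≡)

  nonleaf⇒∉D₀ : ∀ {v} → ¬ Leaf v → inj₁ v ∉ D₀
  nonleaf⇒∉D₀ nv v∈ with ∈-D₀⁻ v∈
  ... | inj₁ (_ , lf , refl) = nv lf
  ... | inj₂ (_ , _ , ())

  ∉D₀⇒nonleaf : ∀ {v} → inj₁ v ∉ D₀ → ¬ Leaf v
  ∉D₀⇒nonleaf v∉ lf = v∉ (leaf∈D₀ lf)

  internal⇒∉D₀ : ∀ {e} → (∀ {w} → w ∈ᴱ e → ¬ Leaf w) → inj₂ e ∉ D₀
  internal⇒∉D₀ internal e∈ with ∈-D₀⁻ e∈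
  ... | inj₁ (_ , _ , ())
  ... | inj₂ (l , lf , refl) = internal (pendant-end l) lf

  ∉D₀⇒internal : ∀ {e w} → inj₂ e ∉ D₀ → w ∈ᴱ e → ¬ Leaf w
  ∉D₀⇒internal e∉ w∈e lw = e∉ (subst (λ f → inj₂ f ∈ D₀) (sym (pendant-unique lw w∈e)) (pendant∈D₀ lw))

  D₀-unique : Unique D₀
  D₀-unique = ++⁺ (map⁺ inj₁-injective leaves-unique)
                  (Unique-map⁺-on (λ x∈ y∈ → pendant-injective (∈-leaves⁻ x∈) (∈-leaves⁻ y∈) ∘ inj₂-injective)
                    leaves-unique)
                  disjoint
    where
    disjoint : ∀ {x} → ¬ (x ∈ map inj₁ leaves × x ∈ map (inj₂ ∘ pendant) leaves)
    disjoint (x∈₁ , x∈₂) with ∈-map⁻ inj₁ x∈₁ | ∈-map⁻ (inj₂ ∘ pendant) x∈₂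
    ... | _ , _ , refl | _ , _ , ()

  length-D₀ : length D₀ ≡ 2 * numLeaves T
  length-D₀ = begin
    length D₀                                                ≡⟨ length-++ (map inj₁ leaves) ⟩
    length (map inj₁ leaves) + length (map (inj₂ ∘ pendant) leaves)
      ≡⟨ cong₂ _+_ (length-map inj₁ leaves) (length-map (inj₂ ∘ pendant) leaves) ⟩
    length leaves + length leaves                            ≡⟨ cong (λ k → k + k) length-leaves ⟩
    numLeaves T + numLeaves T                                ≡⟨ cong (numLeaves T +_) (sym (+-identityʳ _)) ⟩
    2 * numLeaves T                                          ∎
    where open ≡-Reasoning

  neighbour-of-leaf : ∀ {l y} → Leaf l → MAdj T (inj₁ l) y → y ≡ inj₂ (pendant l)
  neighbour-of-leaf {y = inj₂ e} lf l∈e = cong inj₂ (pendant-unique lf l∈e)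

  total⇒pendant∈ : ∀ {D} → IsTotalDominating (Middle T) D → ∀ {l} → Leaf l → inj₂ (pendant l) ∈ D
  total⇒pendant∈ {D} total lf with total (inj₁ _)
  ... | y , y∈D , ly = subst (_∈ D) (neighbour-of-leaf lf ly) y∈D

  TOCDS-length-≥ : ∀ D → Unique D → IsTOCDS (Middle T) D → length D₀ ≤ length D
  TOCDS-length-≥ D D! (total , outer) with all? (λ l → inj₁ l ∈? D) leaves
  ... | yes leaves∈D = Unique-length-≤ D₀-unique D₀⊆D
    where
    D₀⊆D : D₀ ⊆ D
    D₀⊆D x∈ with ∈-D₀⁻ x∈
    ... | inj₁ (_ , lf , refl) = All.lookup leaves∈D (∈-leaves lf)
    ... | inj₂ (_ , lf , refl) = total⇒pendant∈ total lf
  ... | no ¬leaves∈D with find (¬All⇒Any¬ (λ l → inj₁ l ∈? D) leaves ¬leaves∈D)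
  ...   | l₀ , l₀∈ , l₀∉D with nonleaf-exists
  ...     | w₀ , nw₀ = ≤-pred (Unique-length-≤ (¬Any⇒All¬ D₀ (nonleaf⇒∉D₀ nw₀) ∷ D₀-unique) w₀∷D₀⊆l₀∷D)
    where
    lf₀ = ∈-leaves⁻ l₀∈
    others∈D : ∀ y → y ≢ inj₁ l₀ → y ∈ D
    others∈D = OuterConnected-isolated (Middle T) _≟ᴹ_ outer l₀∉D
                 (λ l₀y → subst (_∈ D) (sym (neighbour-of-leaf lf₀ l₀y)) (total⇒pendant∈ total lf₀))
    w₀∷D₀⊆l₀∷D : inj₁ w₀ ∷ D₀ ⊆ inj₁ l₀ ∷ D
    w₀∷D₀⊆l₀∷D {x} _ with x ≟ᴹ inj₁ l₀
    ... | yes x≡l₀ = here x≡l₀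
    ... | no  x≢l₀ = there (others∈D x x≢l₀)

  module D₀-IsTOCDS (acyclic : Acyclic (toGraph T)) {d} (diam : IsDiameter (toGraph T) d) (d≤3 : d ≤ 3) where

    open DiameterAtMost3 acyclic diam d≤3

    D₀-total : IsTotalDominating (Middle T) D₀
    D₀-total (inj₁ v) with leaf? v
    ... | yes lv = inj₂ (pendant v) , pendant∈D₀ lv , pendant-end v
    ... | no  nv with nonleaf-has-leaf-neighbour nv
    ...   | l , lf , vl = inj₂ (pendant l) , pendant∈D₀ lf , pendant-end-at-neighbour lf vl
    D₀-total (inj₂ e@((a , b) , _)) with leaf? a | leaf? b
    ... | yes la | _      = inj₁ a , leaf∈D₀ la , inj₁ refl
    ... | no _   | yes lb = inj₁ b , leaf∈D₀ lb , inj₂ refl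
    ... | no na  | no nb with nonleaf-has-leaf-neighbour na
    ...   | l , lf , al =
      inj₂ (pendant l) , pendant∈D₀ lf , e≢pendant ,
      ends⇒shareEnd e (pendant l) (inj₁ refl) (pendant-end-at-neighbour lf al)
      where
      e≢pendant : proj₁ e ≢ proj₁ (pendant l)
      e≢pendant e≡p with subst (l ∈ᴱ_) (sym (Edge-≡ {e} {pendant l} e≡p)) (pendant-end l)
      ... | inj₁ refl = na lf
      ... | inj₂ refl = nb lf

    Outside : V (Middle T) → Set
    Outside x = x ∉ D₀

    joined-to-nonleaf : ∀ x → Outside x →
      ∃[ v ] ¬ Leaf v × WalkIn (Middle T) Outside x (inj₁ v) × WalkIn (Middle T) Outside (inj₁ v) x
    joined-to-nonleaf (inj₁ v) v∉ = v , ∉D₀⇒nonleaf v∉ , here v∉ , here v∉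
    joined-to-nonleaf (inj₂ e@((a , _) , _)) e∉ =
      a , na , step e∉ (inj₁ refl) (here a∉) , step a∉ (inj₁ refl) (here e∉)
      where
      na = ∉D₀⇒internal e∉ (inj₁ refl)
      a∉ = nonleaf⇒∉D₀ na

    nonleaves-joined : ∀ {u v} → ¬ Leaf u → ¬ Leaf v → WalkIn (Middle T) Outside (inj₁ u) (inj₁ v)
    nonleaves-joined {u} {v} nu nv with u ≟ᶠ v
    ... | yes refl = here (nonleaf⇒∉D₀ nu)
    ... | no  u≢v  =
      step (nonleaf⇒∉D₀ nu) (proj₁ (edge-ends u v uv))
        (step uv∉ (proj₂ (edge-ends u v uv)) (here (nonleaf⇒∉D₀ nv)))
      where
      uv = nonleaves-adjacent nu nv u≢v
      uv∉ : inj₂ (edge u v uv) ∉ D₀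
      uv∉ = internal⇒∉D₀ λ w∈ → case edge-ends⁻ uv w∈ of λ where
        (inj₁ refl) → nu
        (inj₂ refl) → nv

    D₀-outer-connected : OuterConnected (Middle T) D₀
    D₀-outer-connected x y x∉ y∉ with joined-to-nonleaf x x∉ | joined-to-nonleaf y y∉
    ... | u , nu , x→u , _ | v , nv , _ , v→y =
      x→u ++ᵂ nonleaves-joined nu nv ++ᵂ v→y

corollary3p10 : (n : ℕ) (T : SimpleGraph n) → IsTree T → 4 ≤ n →
    (d : ℕ) → IsDiameter (toGraph T) d → 2 ≤ d → d ≤ 3 →
    IsGammaTC (Middle T) (2 * numLeaves T)
corollary3p10 n T (connected , acyclic) n≥4 d diam _ d≤3 =
  (D₀ , D₀-unique , (D₀-total , D₀-outer-connected) , length-D₀) ,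
  λ D D! tocds → subst (_≤ length D) length-D₀ (TOCDS-length-≥ D D! tocds)
  where
  open PendantEdges T connected (≤-trans (n≤1+n 3) n≥4)
  open D₀-IsTOCDS acyclic diam d≤3
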